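{- Optimum Stack Generation over an alphabet $\Sigma$ can be reduced to the scored parsing problem of a bounded-difference scored grammar: there is a scored grammar $G$ with start symbol $S$, of size polynomial in $|\Sigma|$, which is $W$-BD for a constant $W$, such that for every string $\sigma\in\Sigma^*$ the optimum stack generation cost of $\sigma$ equals $s_G(S,\sigma)$; the input string is not changed by the reduction.
   Context: Optimum Stack Generation: given $\sigma\in\Sigma^*$, starting with an empty stack, the minimum length of a sequence of operations push$(c)$ ($c\in\Sigma$), emit (print the top stack symbol) and pop, that prints exactly $\sigma$ and ends with an empty stack. A scored grammar is a context-free grammar in which each production has a non-negative integer score; $s_G(X,\sigma)$ is the minimum total score of a derivation of terminal string $\sigma$ from nonterminal $X$ ($\infty$ if none). It is $W$-BD if for every nonterminal $X$, terminal $x$ and non-empty terminal string $\sigma$: $|s(X,\sigma)-s(X,\sigma x)|\le W$ and $|s(X,\sigma)-s(X,x\sigma)|\le W$. -}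

module Defs where

open import Data.Nat using (ℕ; zero; suc; _+_; _*_; _^_; _≤_)
open import Data.Fin using (Fin)
open import Data.List using (List; []; _∷_; _++_; [_]; length; map; _∷ʳ_)
open import Data.Nat.ListAction using (sum)
open import Data.List.Membership.Propositional using (_∈_)
open import Data.Maybe using (Maybe; just; nothing)
open import Data.Product using (Σ; _×_; _,_; ∃)
open import Data.Sum using (_⊎_; inj₁; inj₂)
open import Data.Unit using (⊤)
open import Data.Empty using (⊥)
open import Relation.Nullary using (¬_)
open import Relation.Binary.PropositionalEquality using (_≡_)

-- Minima of sets of natural numbers, with value in ℕ ∪ {∞}
-- (∞ is represented by `nothing`).

ℕ∞ : Set
ℕ∞ = Maybe ℕ

IsMin : (ℕ → Set) → ℕ∞ → Set
IsMin P (just m) = P m × (∀ m′ → P m′ → m ≤ m′)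
IsMin P nothing  = ∀ m → ¬ P m

-- |u - v| ≤ W on ℕ ∪ {∞}, with |∞ - ∞| = 0 and |∞ - a| = ∞ for finite a.
DiffLe : ℕ → ℕ∞ → ℕ∞ → Set
DiffLe W (just a) (just b) = (a ≤ b + W) × (b ≤ a + W)
DiffLe W (just a) nothing  = ⊥
DiffLe W nothing  (just b) = ⊥
DiffLe W nothing  nothing  = ⊤

data Op (k : ℕ) : Set where
  push : Fin k → Op k
  emit : Op k
  pop  : Op k

-- Run a sequence of operations from a given stack (head = top).
-- Returns the final stack and the printed string, or nothing if some
-- emit/pop is applied to an empty stack.
exec : ∀ {k} → List (Fin k) → List (Op k) → Maybe (List (Fin k) × List (Fin k))
exec stk [] = just (stk , [])
exec stk (push c ∷ ops) = exec (c ∷ stk) ops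
exec [] (emit ∷ ops) = nothing
exec (c ∷ stk) (emit ∷ ops) with exec (c ∷ stk) ops
... | nothing = nothing
... | just (stk′ , out) = just (stk′ , c ∷ out)
exec [] (pop ∷ ops) = nothing
exec (c ∷ stk) (pop ∷ ops) = exec stk ops

Generates : ∀ {k} → List (Fin k) → List (Op k) → Set
Generates σ ops = exec [] ops ≡ just ([] , σ)

StackCost : ∀ {k} → List (Fin k) → ℕ → Set
StackCost {k} σ m = Σ (List (Op k)) λ ops → Generates σ ops × length ops ≡ m

OptStackGen : ∀ {k} → List (Fin k) → ℕ∞ → Set
OptStackGen σ v = IsMin (StackCost σ) v

Sym : ℕ → ℕ → Set
Sym n k = Fin n ⊎ Fin k

record Production (n k : ℕ) : Set where
  constructor prod
  field
    lhs   : Fin n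
    rhs   : List (Sym n k)
    score : ℕ

record ScoredGrammar (k : ℕ) : Set where
  field
    nNT   : ℕ
    start : Fin nNT
    prods : List (Production nNT k)

open ScoredGrammar public

size : ∀ {k} → ScoredGrammar k → ℕ
size G = nNT G + sum (map (λ p → suc (length (Production.rhs p))) (prods G))

mutual
  data DerivesSym {k} (G : ScoredGrammar k) : Sym (nNT G) k → List (Fin k) → ℕ → Set where
    term : ∀ a → DerivesSym G (inj₂ a) [ a ] 0
    rule : ∀ {X rhs w σ s} → prod X rhs w ∈ prods G →
           DerivesSeq G rhs σ s → DerivesSym G (inj₁ X) σ (w + s)

  data DerivesSeq {k} (G : ScoredGrammar k) : List (Sym (nNT G) k) → List (Fin k) → ℕ → Set where
    []  : DerivesSeq G [] [] 0
    _∷_ : ∀ {A As σ₁ σ₂ s₁ s₂} → DerivesSym G A σ₁ s₁ →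
          DerivesSeq G As σ₂ s₂ → DerivesSeq G (A ∷ As) (σ₁ ++ σ₂) (s₁ + s₂)

Score : ∀ {k} (G : ScoredGrammar k) → Fin (nNT G) → List (Fin k) → ℕ∞ → Set
Score G X σ v = IsMin (DerivesSym G (inj₁ X) σ) v

IsBD : ∀ {k} → ℕ → ScoredGrammar k → Set
IsBD {k} W G =
  (∀ (X : Fin (nNT G)) (x : Fin k) (σ : List (Fin k)) → ¬ (σ ≡ []) →
   ∀ (u v : ℕ∞) → Score G X σ u → Score G X (σ ∷ʳ x) v → DiffLe W u v)
  ×
  (∀ (X : Fin (nNT G)) (x : Fin k) (σ : List (Fin k)) → ¬ (σ ≡ []) →
   ∀ (u v : ℕ∞) → Score G X σ u → Score G X (x ∷ σ) v → DiffLe W u v)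

module Submission where

-- A stack program that prints σ and ends with the empty stack has a
-- rigid shape: every push is matched by a later pop, and between them the program
-- emits the pushed symbol or runs further such matched blocks.  We make this shape
-- an inductive family: `Body t σ s` is a sequence of emits of the top symbol t and
-- of blocks (`push d ; Body (just d) ; pop`), printing σ with s operations, where
-- t = nothing means the stack is empty, so no emit is possible.
--
--  * Stack programs of length m generating σ correspond exactly to bodies
--    `Body nothing σ m` (compile a body to operations; parse operations back by
--    keeping one open body per stack cell).
--  * The grammar  S → ε | B S,  B → T_c (score 2),  T_c → ε | c T_c (score 1) | B T_c
--    (one B and one T_c per symbol c) derives from S, B, T_c exactly the bodies on
--    the empty stack, the blocks, and the bodies on top symbol c, with score = length.
--    Hence both minima coincide, and the grammar has 2 + k nonterminals and size 6 + 10k.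
--  * Bounded difference (W = 3): adding a block `push x; emit; pop` at either end of
--    a structure costs 3 more, and deleting one printed symbol never costs more.

open import Defs
open import Data.Nat using (ℕ; _*_; _^_; _≤_; suc)
open import Data.Fin using (Fin)
open import Data.List using (List)
open import Data.Product using (Σ; _×_)

open import Data.Nat using (_+_; s≤s)
open import Data.Nat.Properties
  using (module ≤-Reasoning; +-assoc; +-comm; +-identityʳ; ≤-refl; ≤-trans; m≤n+m; m≤m+n; n≤1+n; +-monoˡ-≤; +-monoʳ-≤)
open import Data.Nat.Tactic.RingSolver using (solve-∀)
open import Data.Nat.ListAction using (sum)
open import Data.Fin using (zero; suc)
open import Data.List using ([]; _∷_; _++_; [_]; _∷ʳ_; length; map; allFin; head)
open import Data.List.Properties using (++-assoc; ++-identityʳ; length-++; ∷-injective; length-tabulate)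
open import Data.List.Membership.Propositional using (_∈_)
open import Data.List.Membership.Propositional.Properties using (∈-allFin; ∈-++⁺ˡ; ∈-++⁺ʳ; ∈-++⁻)
open import Data.List.Relation.Unary.Any using (here; there)
open import Data.Maybe using (Maybe; just; nothing)
open import Data.Product using (_,_; proj₁; proj₂; ∃)
open import Data.Sum using (_⊎_; inj₁; inj₂)
open import Data.Unit using (tt)
open import Relation.Binary.PropositionalEquality using (_≡_; refl; sym; trans; cong; cong₂; subst; subst₂; module ≡-Reasoning)

isMin-transfer : ∀ {A B : ℕ → Set} {v} → (∀ m → A m → B m) → (∀ m → B m → A m) → IsMin A v → IsMin B v
isMin-transfer {v = just m}  f g (Am , minimal) = f m Am , λ m′ Bm′ → minimal m′ (g m′ Bm′)
isMin-transfer {v = nothing} f g empty          = λ m Bm → empty m (g m Bm)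

Dominated : ℕ → (ℕ → Set) → (ℕ → Set) → Set
Dominated W A B = ∀ a → A a → ∃ λ b → B b × b ≤ a + W

isMin-diff : ∀ {W} {A B : ℕ → Set} {u v} → Dominated W A B → Dominated W B A →
             IsMin A u → IsMin B v → DiffLe W u v
isMin-diff {u = just a}  {just b}  f g (Aa , minA) (Bb , minB) =
  let (a′ , Aa′ , a′≤) = g b Bb ; (b′ , Bb′ , b′≤) = f a Aa
  in ≤-trans (minA a′ Aa′) a′≤ , ≤-trans (minB b′ Bb′) b′≤
isMin-diff {u = just a}  {nothing} f g (Aa , _) emptyB = emptyB _ (proj₁ (proj₂ (f a Aa)))
isMin-diff {u = nothing} {just b}  f g emptyA (Bb , _) = emptyA _ (proj₁ (proj₂ (g b Bb)))
isMin-diff {u = nothing} {nothing} f g emptyA emptyB   = tt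

split-++ : ∀ {A : Set} (σ₁ : List A) {σ₂ α x β} → σ₁ ++ σ₂ ≡ α ++ x ∷ β →
           (∃ λ γ → σ₁ ≡ α ++ x ∷ γ × β ≡ γ ++ σ₂) ⊎ (∃ λ δ → α ≡ σ₁ ++ δ × σ₂ ≡ δ ++ x ∷ β)
split-++ []       {α = α}      eq   = inj₂ (α , refl , eq)
split-++ (a ∷ σ₁) {α = []}     refl = inj₁ (σ₁ , refl , refl)
split-++ (a ∷ σ₁) {α = a′ ∷ α} eq with ∷-injective eq
... | refl , eq′ with split-++ σ₁ eq′
...   | inj₁ (γ , p , q) = inj₁ (γ , cong (a ∷_) p , q)
...   | inj₂ (δ , p , q) = inj₂ (δ , cong (a ∷_) p , q)

module Structure (k : ℕ) where

  Str : Set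
  Str = List (Fin k)

  -- Bodies on top symbol t (nothing = empty stack) and blocks, indexed by the printed
  -- string and the number of operations.
  mutual
    data Body : Maybe (Fin k) → Str → ℕ → Set where
      nil   : ∀ {t} → Body t [] 0
      emitB : ∀ {c σ s} → Body (just c) σ s → Body (just c) (c ∷ σ) (suc s)
      blk   : ∀ {t σ τ s u} → Block σ s → Body t τ u → Body t (σ ++ τ) (s + u)

    data Block : Str → ℕ → Set where
      block : ∀ d {σ s} → Body (just d) σ s → Block σ (2 + s)

  _⊕_ : ∀ {t σ τ s u} → Body t σ s → Body t τ u → Body t (σ ++ τ) (s + u)
  nil      ⊕ b′ = b′
  emitB b  ⊕ b′ = emitB (b ⊕ b′)
  blk {σ = σ} {τ} {s} {u} bl b ⊕ b′ =
    subst₂ (Body _) (sym (++-assoc σ τ _)) (sym (+-assoc s u _)) (blk bl (b ⊕ b′))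

  single : ∀ {t σ s} → Block σ s → Body t σ s
  single {σ = σ} {s} bl = subst₂ (Body _) (++-identityʳ σ) (+-identityʳ s) (blk bl nil)

  -- `push x; emit; pop`, the cheapest way to print one symbol.
  unitBlock : ∀ x → Block [ x ] 3
  unitBlock x = block x (emitB nil)

  -- Deleting one printed symbol: drop the emit that prints it; the length does not grow.
  mutual
    delete : ∀ {t σ s} → Body t σ s → ∀ α {x β} → σ ≡ α ++ x ∷ β → ∃ λ s′ → Body t (α ++ β) s′ × s′ ≤ s
    delete nil [] ()
    delete nil (_ ∷ _) ()
    delete (emitB {s = s} b) [] refl = s , b , n≤1+n s
    delete (emitB b) (_ ∷ α) eq with ∷-injective eq
    ... | refl , eq′ = let (s′ , b′ , le) = delete b α eq′ in suc s′ , emitB b′ , s≤s le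
    delete (blk {σ = σ₁} {σ₂} {s₁} {s₂} bl b) α {β = β} eq with split-++ σ₁ eq
    ... | inj₁ (γ , p , q) = let (s′ , bl′ , le) = deleteBlock bl α p in
      s′ + s₂ , subst₂ (Body _) (trans (++-assoc α γ σ₂) (cong (α ++_) (sym q))) refl (blk bl′ b) , +-monoˡ-≤ s₂ le
    ... | inj₂ (δ , p , q) = let (s′ , b′ , le) = delete b δ q in
      s₁ + s′ , subst₂ (Body _) (trans (sym (++-assoc σ₁ δ β)) (cong (_++ β) (sym p))) refl (blk bl b′) , +-monoʳ-≤ s₁ le

    deleteBlock : ∀ {σ s} → Block σ s → ∀ α {x β} → σ ≡ α ++ x ∷ β → ∃ λ s′ → Block (α ++ β) s′ × s′ ≤ s
    deleteBlock (block d b) α eq = let (s′ , b′ , le) = delete b α eq in 2 + s′ , block d b′ , s≤s (s≤s le)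

  mutual
    compile : ∀ {t σ s} → Body t σ s → List (Op k)
    compile nil        = []
    compile (emitB b)  = emit ∷ compile b
    compile (blk bl b) = compileBlock bl ++ compile b

    compileBlock : ∀ {σ s} → Block σ s → List (Op k)
    compileBlock (block d b) = push d ∷ (compile b ++ pop ∷ [])

  mutual
    compile-length : ∀ {t σ s} (b : Body t σ s) → length (compile b) ≡ s
    compile-length nil        = refl
    compile-length (emitB b)  = cong suc (compile-length b)
    compile-length (blk bl b) =
      trans (length-++ (compileBlock bl)) (cong₂ _+_ (compileBlock-length bl) (compile-length b))

    compileBlock-length : ∀ {σ s} (bl : Block σ s) → length (compileBlock bl) ≡ s
    compileBlock-length (block d {s = s} b) = cong suc (begin
      length (compile b ++ pop ∷ [])  ≡⟨ length-++ (compile b) ⟩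
      length (compile b) + 1          ≡⟨ cong (_+ 1) (compile-length b) ⟩
      s + 1                           ≡⟨ +-comm s 1 ⟩
      suc s                           ∎)
      where open ≡-Reasoning

  -- The stack seen by a body on top symbol t, above the rest stk of the stack.
  _◂_ : Maybe (Fin k) → Str → Str
  nothing ◂ stk = stk
  just c  ◂ stk = c ∷ stk

  mutual
    compile-exec : ∀ {t σ s} (b : Body t σ s) {stk rest stk′ out} →
                   exec (t ◂ stk) rest ≡ just (stk′ , out) →
                   exec (t ◂ stk) (compile b ++ rest) ≡ just (stk′ , σ ++ out)
    compile-exec nil e = e
    compile-exec (emitB {c} b) {stk} {rest} e
      with exec (c ∷ stk) (compile b ++ rest) | compile-exec b {stk} {rest} e
    ... | _ | refl = refl
    compile-exec (blk {σ = σ₁} {σ₂} bl b) {rest = rest} {out = out} e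
      rewrite ++-assoc (compileBlock bl) (compile b) rest | ++-assoc σ₁ σ₂ out =
      compileBlock-exec bl (compile-exec b e)

    compileBlock-exec : ∀ {σ s} (bl : Block σ s) {stk rest stk′ out} →
                        exec stk rest ≡ just (stk′ , out) →
                        exec stk (compileBlock bl ++ rest) ≡ just (stk′ , σ ++ out)
    compileBlock-exec (block d b) {stk} {rest} e
      rewrite ++-assoc (compile b) (pop ∷ []) rest = compile-exec b {stk} {pop ∷ rest} e

  body⇒stackCost : ∀ {σ m} → Body nothing σ m → StackCost σ m
  body⇒stackCost {σ} b = compile b , generates , compile-length b
    where
      generates : exec [] (compile b) ≡ just ([] , σ)
      generates = subst₂ (λ ops out → exec [] ops ≡ just ([] , out)) (++-identityʳ (compile b)) (++-identityʳ σ)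
                    (compile-exec b {[]} {[]} refl)

  -- A partially executed program, having reached stack stk: the closed bottom body followed
  -- by one open body per stack cell, each opened by its push (counted in the length).
  data Frames : Str → Str → ℕ → Set where
    bottom : ∀ {ρ s} → Body nothing ρ s → Frames [] ρ s
    frame  : ∀ {stk ρ s d τ u} → Frames stk ρ s → Body (just d) τ u → Frames (d ∷ stk) (ρ ++ τ) (s + suc u)

  extend : ∀ {stk ρ s τ u} → Frames stk ρ s → Body (head stk) τ u → Frames stk (ρ ++ τ) (s + u)
  extend (bottom b) b′ = bottom (b ⊕ b′)
  extend (frame {ρ = ρ} {s} {τ = τ} {u} F b) b′ =
    subst₂ (Frames _) (sym (++-assoc ρ τ _)) (sym (+-assoc s (suc u) _)) (frame F (b ⊕ b′))

  pushF : ∀ {stk ρ s} d → Frames stk ρ s → Frames (d ∷ stk) ρ (s + 1)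
  pushF d F = subst₂ (Frames _) (++-identityʳ _) refl (frame F nil)

  emitF : ∀ {d stk ρ s} → Frames (d ∷ stk) ρ s → Frames (d ∷ stk) (ρ ++ [ d ]) (s + 1)
  emitF F = extend F (emitB nil)

  -- Popping closes the innermost open body into a block of the body below.
  popF : ∀ {d stk ρ s} → Frames (d ∷ stk) ρ s → Frames stk ρ (s + 1)
  popF (frame {s = s} {d} {u = u} F b) =
    subst₂ (Frames _) refl (block-cost s u) (extend F (single (block d b)))
    where
      block-cost : ∀ s u → s + (2 + u) ≡ s + suc u + 1
      block-cost = solve-∀

  parse : ∀ ops {stk ρ s stk′ out} → Frames stk ρ s → exec stk ops ≡ just (stk′ , out) →
          Frames stk′ (ρ ++ out) (s + length ops)
  parse [] {ρ = ρ} {s} F refl = subst₂ (Frames _) (sym (++-identityʳ ρ)) (sym (+-identityʳ s)) F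
  parse (push d ∷ ops) {s = s} F e = subst₂ (Frames _) refl (+-assoc s 1 _) (parse ops (pushF d F) e)
  parse (emit ∷ ops) {[]} F ()
  parse (emit ∷ ops) {d ∷ stk} F e with exec (d ∷ stk) ops in e′
  parse (emit ∷ ops) {d ∷ stk} F () | nothing
  parse (emit ∷ ops) {d ∷ stk} {ρ} {s} F refl | just (_ , out) =
    subst₂ (Frames _) (++-assoc ρ [ d ] out) (+-assoc s 1 _) (parse ops (emitF F) e′)
  parse (pop ∷ ops) {[]} F ()
  parse (pop ∷ ops) {d ∷ stk} {s = s} F e = subst₂ (Frames _) refl (+-assoc s 1 _) (parse ops (popF F) e)

  stackCost⇒body : ∀ {σ m} → StackCost σ m → Body nothing σ m
  stackCost⇒body (ops , generates , refl) with parse ops (bottom nil) generates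
  ... | bottom b = b

module Grammar (k : ℕ) where
  open Structure k

  -- Nonterminals: S (bodies on the empty stack), B (blocks), T c (bodies on top symbol c).
  NT : Set
  NT = Fin (2 + k)

  S B : NT
  S = zero
  B = suc zero

  T : Fin k → NT
  T c = suc (suc c)

  nt : NT → Sym (2 + k) k
  nt = inj₁

  tm : Fin k → Sym (2 + k) k
  tm = inj₂

  Rule : Set
  Rule = Production (2 + k) k

  startRules : List Rule
  startRules = prod S [] 0 ∷ prod S (nt B ∷ nt S ∷ []) 0 ∷ []

  symbolRules : Fin k → List Rule
  symbolRules c = prod B (nt (T c) ∷ []) 2 ∷ prod (T c) [] 0 ∷ prod (T c) (tm c ∷ nt (T c) ∷ []) 1
                ∷ prod (T c) (nt B ∷ nt (T c) ∷ []) 0 ∷ []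

  rules : List (Fin k) → List Rule
  rules []       = startRules
  rules (c ∷ cs) = symbolRules c ++ rules cs

  G : ScoredGrammar k
  G = record { nNT = 2 + k ; start = S ; prods = rules (allFin k) }

  -- Each symbol contributes 4 rules of total size 9, the start rules size 4.
  rules-size : ∀ cs → sum (map (λ p → suc (length (Production.rhs p))) (rules cs)) ≡ 4 + length cs * 9
  rules-size []       = refl
  rules-size (c ∷ cs) = cong (9 +_) (rules-size cs)

  size-G : size G ≤ 10 * suc k ^ 1
  size-G = begin
    size G                     ≡⟨ cong (2 + k +_) (rules-size (allFin k)) ⟩
    2 + k + (4 + length (allFin k) * 9) ≡⟨ cong (λ n → 2 + k + (4 + n * 9)) (length-tabulate {n = k} (λ i → i)) ⟩
    2 + k + (4 + k * 9)        ≡⟨ total k ⟩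
    6 + k * 10                 ≤⟨ m≤n+m (6 + k * 10) 4 ⟩
    4 + (6 + k * 10)           ≡⟨ bound k ⟩
    10 * suc k ^ 1             ∎
    where
      open ≤-Reasoning
      total : ∀ n → 2 + n + (4 + n * 9) ≡ 6 + n * 10
      total = solve-∀
      bound : ∀ n → 4 + (6 + n * 10) ≡ 10 * (suc n * 1)
      bound = solve-∀

  startRule∈ : ∀ {p} cs → p ∈ startRules → p ∈ rules cs
  startRule∈ []       p∈ = p∈
  startRule∈ (c ∷ cs) p∈ = ∈-++⁺ʳ (symbolRules c) (startRule∈ cs p∈)

  symbolRule∈ : ∀ {p c cs} → c ∈ cs → p ∈ symbolRules c → p ∈ rules cs
  symbolRule∈ (here refl) p∈ = ∈-++⁺ˡ p∈
  symbolRule∈ {cs = c′ ∷ _} (there c∈) p∈ = ∈-++⁺ʳ (symbolRules c′) (symbolRule∈ c∈ p∈)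

  data Kind : Rule → Set where
    S→ε   : Kind (prod S [] 0)
    S→BS  : Kind (prod S (nt B ∷ nt S ∷ []) 0)
    B→T   : ∀ c → Kind (prod B (nt (T c) ∷ []) 2)
    T→ε   : ∀ c → Kind (prod (T c) [] 0)
    T→cT  : ∀ c → Kind (prod (T c) (tm c ∷ nt (T c) ∷ []) 1)
    T→BT  : ∀ c → Kind (prod (T c) (nt B ∷ nt (T c) ∷ []) 0)

  kind : ∀ {p} cs → p ∈ rules cs → Kind p
  kind [] (here refl)         = S→ε
  kind [] (there (here refl)) = S→BS
  kind (c ∷ cs) p∈ with ∈-++⁻ (symbolRules c) p∈
  ... | inj₁ (here refl)                         = B→T c
  ... | inj₁ (there (here refl))                 = T→ε c
  ... | inj₁ (there (there (here refl)))         = T→cT c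
  ... | inj₁ (there (there (there (here refl)))) = T→BT c
  ... | inj₂ p∈′                                 = kind cs p∈′

  -- What each nonterminal derives, with score = number of operations.
  Meaning : NT → Str → ℕ → Set
  Meaning zero          = Body nothing
  Meaning (suc zero)    = Block
  Meaning (suc (suc c)) = Body (just c)

  Derives : Sym (2 + k) k → Str → ℕ → Set
  Derives = DerivesSym G

  -- A derivation of a right-hand side ends with the derivation of the empty sequence.
  rhs-string : ∀ (σ₁ σ₂ : Str) → σ₁ ++ σ₂ ≡ σ₁ ++ (σ₂ ++ [])
  rhs-string σ₁ σ₂ = cong (σ₁ ++_) (sym (++-identityʳ σ₂))

  rhs-score : ∀ s₁ s₂ → s₁ + s₂ ≡ s₁ + (s₂ + 0)
  rhs-score s₁ s₂ = cong (s₁ +_) (sym (+-identityʳ s₂))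

  derivation⇒meaning : ∀ {X σ s} → Derives (nt X) σ s → Meaning X σ s
  derivation⇒meaning (rule r∈ d) with kind (allFin k) r∈
  derivation⇒meaning (rule _ []) | S→ε = nil
  derivation⇒meaning (rule _ (_∷_ {σ₁ = σ₁} {s₁ = s₁} dB (_∷_ {σ₁ = σ₂} {s₁ = s₂} dS []))) | S→BS =
    subst₂ (Body _) (rhs-string σ₁ σ₂) (rhs-score s₁ s₂) (blk (derivation⇒meaning dB) (derivation⇒meaning dS))
  derivation⇒meaning (rule _ (_∷_ {σ₁ = σ} {s₁ = s} dT [])) | B→T c =
    subst₂ Block (sym (++-identityʳ σ)) (cong (2 +_) (sym (+-identityʳ s))) (block c (derivation⇒meaning dT))
  derivation⇒meaning (rule _ []) | T→ε c = nil
  derivation⇒meaning (rule _ (term _ ∷ (_∷_ {σ₁ = σ} {s₁ = s} dT []))) | T→cT c =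
    subst₂ (Body _) (rhs-string [ c ] σ) (cong suc (rhs-score 0 s)) (emitB (derivation⇒meaning dT))
  derivation⇒meaning (rule _ (_∷_ {σ₁ = σ₁} {s₁ = s₁} dB (_∷_ {σ₁ = σ₂} {s₁ = s₂} dT []))) | T→BT c =
    subst₂ (Body _) (rhs-string σ₁ σ₂) (rhs-score s₁ s₂) (blk (derivation⇒meaning dB) (derivation⇒meaning dT))

  derive₀ : ∀ {X w} → prod X [] w ∈ prods G → Derives (nt X) [] w
  derive₀ r∈ = subst₂ (Derives _) refl (+-identityʳ _) (rule r∈ [])

  derive₁ : ∀ {X A w σ s} → prod X (A ∷ []) w ∈ prods G → Derives A σ s → Derives (nt X) σ (w + s)
  derive₁ {w = w} {σ} {s} r∈ d = subst₂ (Derives _) (++-identityʳ σ) (sym (rhs-score w s)) (rule r∈ (d ∷ []))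

  derive₂ : ∀ {X A A′ w σ s σ′ s′} → prod X (A ∷ A′ ∷ []) w ∈ prods G → Derives A σ s → Derives A′ σ′ s′ →
            Derives (nt X) (σ ++ σ′) (w + (s + s′))
  derive₂ {w = w} {σ} {s} {σ′} {s′} r∈ d d′ =
    subst₂ (Derives _) (sym (rhs-string σ σ′)) (cong (w +_) (sym (rhs-score s s′))) (rule r∈ (d ∷ d′ ∷ []))

  mutual
    body⇒derivation : ∀ {c σ s} → Body (just c) σ s → Derives (nt (T c)) σ s
    body⇒derivation {c} nil        = derive₀ (symbolRule∈ (∈-allFin c) (there (here refl)))
    body⇒derivation {c} (emitB b)  = derive₂ (symbolRule∈ (∈-allFin c) (there (there (here refl))))
                                       (term c) (body⇒derivation b)
    body⇒derivation {c} (blk bl b) = derive₂ (symbolRule∈ (∈-allFin c) (there (there (there (here refl)))))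
                                       (block⇒derivation bl) (body⇒derivation b)

    block⇒derivation : ∀ {σ s} → Block σ s → Derives (nt B) σ s
    block⇒derivation (block d b) = derive₁ (symbolRule∈ (∈-allFin d) (here refl)) (body⇒derivation b)

  emptyBody⇒derivation : ∀ {σ s} → Body nothing σ s → Derives (nt S) σ s
  emptyBody⇒derivation nil        = derive₀ (startRule∈ (allFin k) (here refl))
  emptyBody⇒derivation (blk bl b) = derive₂ (startRule∈ (allFin k) (there (here refl)))
                                      (block⇒derivation bl) (emptyBody⇒derivation b)

  meaning⇒derivation : ∀ X {σ s} → Meaning X σ s → Derives (nt X) σ s
  meaning⇒derivation zero          = emptyBody⇒derivation
  meaning⇒derivation (suc zero)    = block⇒derivation
  meaning⇒derivation (suc (suc c)) = body⇒derivation

  score⇔meaning : ∀ X σ v → (Score G X σ v → IsMin (Meaning X σ) v) × (IsMin (Meaning X σ) v → Score G X σ v)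
  score⇔meaning X σ v = isMin-transfer (λ _ → derivation⇒meaning) (λ _ → meaning⇒derivation X) ,
                        isMin-transfer (λ _ → meaning⇒derivation X) (λ _ → derivation⇒meaning)

  optStackGen⇔score : ∀ σ v → (OptStackGen σ v → Score G S σ v) × (Score G S σ v → OptStackGen σ v)
  optStackGen⇔score σ v =
    (λ opt → proj₂ (score⇔meaning S σ v) (isMin-transfer (λ _ → stackCost⇒body) (λ _ → body⇒stackCost) opt)) ,
    (λ sc → isMin-transfer (λ _ → body⇒stackCost) (λ _ → stackCost⇒body) (proj₁ (score⇔meaning S σ v) sc))

  meaning-snoc : ∀ X x {σ s} → Meaning X σ s → Meaning X (σ ∷ʳ x) (s + 3)
  meaning-snoc zero          x b           = b ⊕ single (unitBlock x)
  meaning-snoc (suc zero)    x (block d b) = block d (b ⊕ single (unitBlock x))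
  meaning-snoc (suc (suc c)) x b           = b ⊕ single (unitBlock x)

  meaning-cons : ∀ X x {σ s} → Meaning X σ s → Meaning X (x ∷ σ) (s + 3)
  meaning-cons zero          x {s = s} b = subst₂ (Body _) refl (+-comm 3 s) (blk (unitBlock x) b)
  meaning-cons (suc zero)    x (block d {s = s} b) =
    subst₂ Block refl (cong (2 +_) (+-comm 3 s)) (block d (blk (unitBlock x) b))
  meaning-cons (suc (suc c)) x {s = s} b = subst₂ (Body _) refl (+-comm 3 s) (blk (unitBlock x) b)

  meaning-delete : ∀ X α {x β s} → Meaning X (α ++ x ∷ β) s → ∃ λ s′ → Meaning X (α ++ β) s′ × s′ ≤ s
  meaning-delete zero          α b  = delete b α refl
  meaning-delete (suc zero)    α bl = deleteBlock bl α refl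
  meaning-delete (suc (suc c)) α b  = delete b α refl

  dominated-by-deletion : ∀ W X α x β → Dominated W (Meaning X (α ++ x ∷ β)) (Meaning X (α ++ β))
  dominated-by-deletion W X α x β s m =
    let (s′ , m′ , s′≤s) = meaning-delete X α m in s′ , m′ , ≤-trans s′≤s (m≤m+n s W)

  dominated-by-snoc : ∀ X x σ → Dominated 3 (Meaning X σ) (Meaning X (σ ∷ʳ x))
  dominated-by-snoc X x σ s m = s + 3 , meaning-snoc X x m , ≤-refl

  dominated-by-cons : ∀ X x σ → Dominated 3 (Meaning X σ) (Meaning X (x ∷ σ))
  dominated-by-cons X x σ s m = s + 3 , meaning-cons X x m , ≤-refl

  isBD : IsBD 3 G
  isBD = (λ X x σ _ u v su sv → isMin-diff (dominated-by-snoc X x σ) (dropLast X x σ) (meaning-min su) (meaning-min sv)) ,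
         (λ X x σ _ u v su sv → isMin-diff (dominated-by-cons X x σ) (dominated-by-deletion 3 X [] x σ)
                                           (meaning-min su) (meaning-min sv))
    where
      meaning-min : ∀ {X σ v} → Score G X σ v → IsMin (Meaning X σ) v
      meaning-min {X} {σ} {v} = proj₁ (score⇔meaning X σ v)

      dropLast : ∀ X x σ → Dominated 3 (Meaning X (σ ∷ʳ x)) (Meaning X σ)
      dropLast X x σ = subst (λ τ → Dominated 3 (Meaning X (σ ∷ʳ x)) (Meaning X τ)) (++-identityʳ σ)
                             (dominated-by-deletion 3 X σ x [])

proposition2 : Σ ℕ λ W → Σ ℕ λ c → Σ ℕ λ d →
    (k : ℕ) → Σ (ScoredGrammar k) λ G →
    (size G ≤ c * (suc k) ^ d) × IsBD W G ×
    ((σ : List (Fin k)) (v : ℕ∞) → (OptStackGen σ v → Score G (start G) σ v) × (Score G (start G) σ v → OptStackGen σ v))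
proposition2 = 3 , 10 , 1 , λ k → let open Grammar k in G , size-G , isBD , optStackGen⇔score
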